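{- Let $\ell\geq1$, let $(G,k)$ be an instance of $\ell$-\textsc{Component Order Connectivity}, and let $(X,Y)$ be a reducible pair in $G$. If $(G,k)$ is a yes-instance, then there exists a set $S\subseteq V(G)$ with $|S|\leq k$ such that every connected component of $G-S$ has at most $\ell$ vertices, $X\subseteq S$, and $S\cap Y=\emptyset$.
   Context: $\ell$-\textsc{Component Order Connectivity}: given a graph $G$ and integer $k\geq0$, decide whether there is $S\subseteq V(G)$, $|S|\leq k$, such that every connected component of $G-S$ has at most $\ell$ vertices. For $Y\subseteq V(G)$, $N(Y)$ is the set of vertices outside $Y$ adjacent to some vertex of $Y$. For disjoint $X,Y\subseteq V(G)$, $\tilde{G}_{XY}$ is the bipartite graph with parts $X$ and $\tilde{Y}$, where $\tilde{Y}$ contains one vertex $c_C$ for each connected component $C$ of $G[Y]$, $x\in X$ is adjacent to $c_C$ iff $x$ has a neighbour in $C$, and $c_C$ has capacity $w(c_C)=|V(C)|$. A weighted $q$-expansion in $\tilde{G}_{XY}$ is an edge weight function $f:E(\tilde{G}_{XY})\to\mathbb{N}$ with $\sum_{x}f(xc)\leq w(c)$ for every $c\in\tilde{Y}$ and $\sum_{c}f(xc)\geq q$ for every $x\in X$. A pair $(X,Y)$ of disjoint subsets of $V(G)$ is a reducible pair if $N(Y)\subseteq X$, every connected component of $G[Y]$ has at most $\ell$ vertices, and there is a weighted $(2\ell-1)$-expansion in $\tilde{G}_{XY}$. -}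

module Defs where

open import Data.Nat using (ℕ; zero; suc; _+_; _*_; _∸_; _≤_; _≥_)
open import Data.Fin using (Fin; zero; suc)
open import Data.Fin.Subset using (Subset; _∈_; _∉_; _⊆_; ∁; ∣_∣)
open import Data.Fin.Subset.Properties using (_∈?_)
open import Data.Product using (Σ; ∃; _×_; _,_)
open import Relation.Nullary using (¬_; yes; no)
open import Relation.Binary.PropositionalEquality using (_≡_; _≢_)
open import Function.Bundles using (_⇔_)
open import Data.Fin using (_≟_)

record Graph : Set₁ where
  field
    n     : ℕ
    Adj   : Fin n → Fin n → Set
    sym   : ∀ {u v} → Adj u v → Adj v u
    irrefl : ∀ {u} → ¬ Adj u u
open Graph public

data Walk (G : Graph) (U : Subset (n G)) (v : Fin (n G)) : Fin (n G) → Set where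
  here : v ∈ U → Walk G U v v
  step : ∀ {u w} → Walk G U v u → Adj G u w → w ∈ U → Walk G U v w

-- Every connected component of G[U] has at most ℓ vertices:
-- the component of every v ∈ U is contained in a set of size ≤ ℓ.
SmallComponents : (G : Graph) → ℕ → Subset (n G) → Set
SmallComponents G ℓ U =
  ∀ v → v ∈ U → Σ (Subset (n G)) λ C → (∣ C ∣ ≤ ℓ) × (∀ w → Walk G U v w → w ∈ C)

IsCOCSolution : (G : Graph) → ℕ → Subset (n G) → Set
IsCOCSolution G ℓ S = SmallComponents G ℓ (∁ S)

YesInstance : ℕ → (G : Graph) → ℕ → Set
YesInstance ℓ G k = Σ (Subset (n G)) λ S → (∣ S ∣ ≤ k) × IsCOCSolution G ℓ S

sumFin : (m : ℕ) → (Fin m → ℕ) → ℕ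
sumFin zero    f = 0
sumFin (suc m) f = f zero + sumFin m (λ i → f (suc i))

restrict : ∀ {m} → Subset m → (Fin m → ℕ) → Fin m → ℕ
restrict A f x with x ∈? A
... | yes _ = f x
... | no  _ = 0

-- A labelling of the connected components of G[Y] by Fin m:
-- vertices of Y in the same component get the same label and conversely,
-- and every label is used by some vertex of Y.
record ComponentLabelling (G : Graph) (Y : Subset (n G)) (m : ℕ) : Set where
  field
    comp    : Fin (n G) → Fin m
    correct : ∀ y y' → y ∈ Y → y' ∈ Y → (comp y ≡ comp y' ⇔ Walk G Y y y')
    onto    : ∀ c → Σ (Fin (n G)) λ y → (y ∈ Y) × (comp y ≡ c)
open ComponentLabelling public

-- capacity w(c_C) = |V(C)|
capacity : ∀ {G Y m} → ComponentLabelling G Y m → Fin m → ℕ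
capacity {G} {Y} L c = sumFin (n G) (restrict Y (λ y → indicator (comp L y) c))
  where
  indicator : Fin _ → Fin _ → ℕ
  indicator a b with a ≟ b
  ... | yes _ = 1
  ... | no  _ = 0

AdjComp : ∀ {G Y m} → ComponentLabelling G Y m → Fin (n G) → Fin m → Set
AdjComp {G} {Y} L x c = Σ (Fin (n G)) λ y → (y ∈ Y) × (comp L y ≡ c) × Adj G x y

IsWeightedExpansion : ∀ {G Y m} → ComponentLabelling G Y m → Subset (n G) → ℕ →
                      (Fin (n G) → Fin m → ℕ) → Set
IsWeightedExpansion {G} {Y} {m} L X q f =
  (∀ x c → f x c ≢ 0 → (x ∈ X) × AdjComp L x c) ×
  (∀ c → sumFin (n G) (λ x → f x c) ≤ capacity L c) ×
  (∀ x → x ∈ X → sumFin m (λ c → f x c) ≥ q)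

HasWeightedExpansion : (G : Graph) → Subset (n G) → Subset (n G) → ℕ → Set
HasWeightedExpansion G X Y q =
  Σ ℕ λ m → Σ (ComponentLabelling G Y m) λ L →
    Σ (Fin (n G) → Fin m → ℕ) λ f → IsWeightedExpansion L X q f

ReduciblePair : ℕ → (G : Graph) → Subset (n G) → Subset (n G) → Set
ReduciblePair ℓ G X Y =
  (∀ v → v ∈ X → v ∉ Y) ×
  (∀ y v → y ∈ Y → v ∉ Y → Adj G y v → v ∈ X) ×
  SmallComponents G ℓ Y ×
  HasWeightedExpansion G X Y (2 * ℓ ∸ 1)

-- Let S be any solution and S′ = (S ∖ Y) ∪ (X ∖ S). It contains X, avoids Y, and is again a
-- solution: since N(Y) ⊆ X ⊆ S′, a component of G − S′ lies either inside G[Y] or inside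
-- G − S − Y. So it remains to show |X ∖ S| ≤ |S ∩ Y|. Take x ∈ X ∖ S. The components of G[Y]
-- that avoid S and carry weight from x lie, together with x, in the component of x in G − S, so
-- they receive less than ℓ of the weight of x; at least (2ℓ − 1) − (ℓ − 1) = ℓ of it therefore
-- goes to components meeting S. Summing over x, the components meeting S receive at least
-- ℓ|X ∖ S| in total, while each of them receives at most its capacity ≤ ℓ and there are at most
-- |S ∩ Y| of them.
module Submission where

open import Level using (Level)
open import Data.Nat using (ℕ; zero; suc; _+_; _*_; _∸_; _≤_; _<_; z≤n; s≤s; >-nonZero)
import Data.Nat as ℕ
open import Data.Nat.Properties hiding (_≟_)
open import Data.Bool using (if_then_else_)
open import Data.Fin using (Fin; zero; suc; _≟_)
open import Data.Fin.Properties using (any?)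
open import Data.Fin.Subset using (Subset; _∈_; _∉_; _⊆_; ∁; _∩_; _∪_; ∣_∣; inside; outside)
open import Data.Fin.Subset.Properties
  using (_∈?_; x∈∁p⇒x∉p; x∉p⇒x∈∁p; x∈p∩q⁺; x∈p∩q⁻; x∈p∪q⁺; x∈p∪q⁻)
open import Data.Vec using (_∷_; [])
open import Data.Product using (Σ; _×_; _,_; proj₁; proj₂)
open import Data.Sum using (inj₁; inj₂)
open import Data.Empty using (⊥; ⊥-elim)
open import Function.Base using (_∘_)
open import Function.Bundles using (Equivalence)
open import Relation.Nullary using (Dec; does; yes; no; ¬_; ¬?; _×-dec_)
open import Relation.Binary.PropositionalEquality
  using (_≡_; _≢_; refl; sym; trans; cong; cong₂; module ≡-Reasoning)
open import Algebra.Properties.Semiring.Sum +-*-semiring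
  using (sum; sum-cong-≗; ∑-distrib-+; ∑-comm; *-distribˡ-sum; *-distribʳ-sum)

open import Defs hiding (sym)

private
  variable
    p q r : Level
    P : Set p
    Q : Set q
    R : Set r

-- Defined through does rather than by matching on yes/no, so that 𝟙 (suc i ≟ suc j) and
-- 𝟙 (suc i ∈? x ∷ s) reduce to 𝟙 (i ≟ j) and 𝟙 (i ∈? s).
𝟙 : Dec P → ℕ
𝟙 p? = if does p? then 1 else 0

𝟙-≡1 : (p? : Dec P) → P → 𝟙 p? ≡ 1
𝟙-≡1 (yes _) _  = refl
𝟙-≡1 (no ¬p) p = ⊥-elim (¬p p)

𝟙+𝟙¬≡1 : (p? : Dec P) → 𝟙 p? + 𝟙 (¬? p?) ≡ 1
𝟙+𝟙¬≡1 (yes _) = refl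
𝟙+𝟙¬≡1 (no _)  = refl

𝟙-×-dec : (p? : Dec P) (q? : Dec Q) → 𝟙 (p? ×-dec q?) ≡ 𝟙 p? * 𝟙 q?
𝟙-×-dec (yes _) (yes _) = refl
𝟙-×-dec (yes _) (no _)  = refl
𝟙-×-dec (no _)  _       = refl

𝟙-mono : (p? : Dec P) (q? : Dec Q) → (P → Q) → 𝟙 p? ≤ 𝟙 q?
𝟙-mono (yes _) (yes _) _   = ≤-refl
𝟙-mono (yes p) (no ¬q) p⇒q = ⊥-elim (¬q (p⇒q p))
𝟙-mono (no _)  _       _   = z≤n

𝟙+𝟙-≤ : (p? : Dec P) (q? : Dec Q) (r? : Dec R) →
        (P → Q → ⊥) → (P → R) → (Q → R) → 𝟙 p? + 𝟙 q? ≤ 𝟙 r?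
𝟙+𝟙-≤ (yes p) (yes q) _  disjoint _   _   = ⊥-elim (disjoint p q)
𝟙+𝟙-≤ (yes p) (no _)  r? _        p⇒r _   = 𝟙-mono (yes p) r? p⇒r
𝟙+𝟙-≤ (no _)  q?      r? _        _   q⇒r = 𝟙-mono q? r? q⇒r

𝟙-≤ : ∀ {b} (p? : Dec P) → (P → 1 ≤ b) → 𝟙 p? ≤ b
𝟙-≤ (yes p) 1≤b = 1≤b p
𝟙-≤ (no _)  _   = z≤n

𝟙-*-≤ : ∀ {a b} (p? : Dec P) → (P → a ≤ b) → 𝟙 p? * a ≤ b
𝟙-*-≤ {a = a} (yes p) a≤b = ≤-trans (≤-reflexive (*-identityˡ a)) (a≤b p)
𝟙-*-≤         (no _)  _   = z≤n

𝟙-*-≤-support : ∀ {a b} (p? : Dec P) → a ≤ b → 𝟙 p? * a ≤ 𝟙 (p? ×-dec ¬? (a ℕ.≟ 0)) * b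
𝟙-*-≤-support         (no _)  _   = z≤n
𝟙-*-≤-support {a = zero}  (yes _) _   = z≤n
𝟙-*-≤-support {a = suc _} (yes _) a≤b = *-monoʳ-≤ 1 a≤b

2*m∸1≤n+o⇒o<m⇒m≤n : ∀ {m n o} → 2 * m ∸ 1 ≤ n + o → o < m → m ≤ n
2*m∸1≤n+o⇒o<m⇒m≤n {suc l} {n} {o} 2m∸1≤n+o (s≤s o≤l) = +-cancelʳ-≤ l (suc l) n (begin
  suc l + l         ≡⟨ +-comm (suc l) l ⟩
  l + suc l         ≡⟨ cong (l +_) (sym (+-identityʳ (suc l))) ⟩
  l + (suc l + 0)   ≤⟨ 2m∸1≤n+o ⟩
  n + o             ≤⟨ +-monoʳ-≤ n o≤l ⟩
  n + l             ∎)
  where open ≤-Reasoning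

sumFin≡sum : ∀ m (f : Fin m → ℕ) → sumFin m f ≡ sum f
sumFin≡sum zero    f = refl
sumFin≡sum (suc m) f = cong (f zero +_) (sumFin≡sum m (f ∘ suc))

sum-mono-≤ : ∀ {m} {f g : Fin m → ℕ} → (∀ i → f i ≤ g i) → sum f ≤ sum g
sum-mono-≤ {zero}  f≤g = z≤n
sum-mono-≤ {suc m} f≤g = +-mono-≤ (f≤g zero) (sum-mono-≤ (λ i → f≤g (suc i)))

≤-sum : ∀ {m} (f : Fin m → ℕ) i → f i ≤ sum f
≤-sum f zero    = m≤m+n _ _
≤-sum f (suc i) = ≤-trans (≤-sum (f ∘ suc) i) (m≤n+m _ _)

∑-*-𝟙-≟ : ∀ {m} (g : Fin m → ℕ) a → sum (λ c → g c * 𝟙 (a ≟ c)) ≡ g a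
∑-*-𝟙-≟ {suc m} g zero = begin
  g zero * 1 + sum (λ c → g (suc c) * 0)
    ≡⟨ cong₂ _+_ (*-identityʳ (g zero)) (sym (*-distribʳ-sum 0 (g ∘ suc))) ⟩
  g zero + sum (g ∘ suc) * 0
    ≡⟨ cong (g zero +_) (*-zeroʳ (sum (g ∘ suc))) ⟩
  g zero + 0
    ≡⟨ +-identityʳ (g zero) ⟩
  g zero ∎
  where open ≡-Reasoning
∑-*-𝟙-≟ {suc m} g (suc a) =
  trans (cong (_+ sum (λ c → g (suc c) * 𝟙 (a ≟ c))) (*-zeroʳ (g zero))) (∑-*-𝟙-≟ (g ∘ suc) a)

∑-𝟙-≟ : ∀ {m} (a : Fin m) → sum (λ c → 𝟙 (a ≟ c)) ≡ 1
∑-𝟙-≟ a = trans (sum-cong-≗ (λ c → sym (*-identityˡ (𝟙 (a ≟ c))))) (∑-*-𝟙-≟ (λ _ → 1) a)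

∑-∑-*-𝟙-≟ : ∀ {m k} (label : Fin k → Fin m) (g : Fin k → Fin m → ℕ) →
            sum (λ c → sum (λ i → g i c * 𝟙 (label i ≟ c))) ≡ sum (λ i → g i (label i))
∑-∑-*-𝟙-≟ label g =
  trans (∑-comm (λ c i → g i c * 𝟙 (label i ≟ c))) (sum-cong-≗ (λ i → ∑-*-𝟙-≟ (g i) (label i)))

∣p∣≡∑𝟙 : ∀ {n} (p : Subset n) → ∣ p ∣ ≡ sum (λ i → 𝟙 (i ∈? p))
∣p∣≡∑𝟙 []            = refl
∣p∣≡∑𝟙 (inside  ∷ p) = cong suc (∣p∣≡∑𝟙 p)
∣p∣≡∑𝟙 (outside ∷ p) = ∣p∣≡∑𝟙 p

∣p∪q∣≤∣p∣+∣q∣ : ∀ {n} (p q : Subset n) → ∣ p ∪ q ∣ ≤ ∣ p ∣ + ∣ q ∣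
∣p∪q∣≤∣p∣+∣q∣ []            []            = z≤n
∣p∪q∣≤∣p∣+∣q∣ (inside  ∷ p) (inside  ∷ q) =
  s≤s (≤-trans (∣p∪q∣≤∣p∣+∣q∣ p q) (+-monoʳ-≤ ∣ p ∣ (n≤1+n ∣ q ∣)))
∣p∪q∣≤∣p∣+∣q∣ (inside  ∷ p) (outside ∷ q) = s≤s (∣p∪q∣≤∣p∣+∣q∣ p q)
∣p∪q∣≤∣p∣+∣q∣ (outside ∷ p) (inside  ∷ q) =
  ≤-trans (s≤s (∣p∪q∣≤∣p∣+∣q∣ p q)) (≤-reflexive (sym (+-suc ∣ p ∣ ∣ q ∣)))
∣p∪q∣≤∣p∣+∣q∣ (outside ∷ p) (outside ∷ q) = ∣p∪q∣≤∣p∣+∣q∣ p q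

∣p∣≡∣p∩q∣+∣p∩∁q∣ : ∀ {n} (p q : Subset n) → ∣ p ∣ ≡ ∣ p ∩ q ∣ + ∣ p ∩ ∁ q ∣
∣p∣≡∣p∩q∣+∣p∩∁q∣ []            []            = refl
∣p∣≡∣p∩q∣+∣p∩∁q∣ (inside  ∷ p) (inside  ∷ q) = cong suc (∣p∣≡∣p∩q∣+∣p∩∁q∣ p q)
∣p∣≡∣p∩q∣+∣p∩∁q∣ (inside  ∷ p) (outside ∷ q) =
  trans (cong suc (∣p∣≡∣p∩q∣+∣p∩∁q∣ p q)) (sym (+-suc ∣ p ∩ q ∣ ∣ p ∩ ∁ q ∣))
∣p∣≡∣p∩q∣+∣p∩∁q∣ (outside ∷ p) (_       ∷ q) = ∣p∣≡∣p∩q∣+∣p∩∁q∣ p q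

module _ {G : Graph} where

  walk-end : ∀ {U v w} → Walk G U v w → w ∈ U
  walk-end (here w∈U)     = w∈U
  walk-end (step _ _ w∈U) = w∈U

  walk-prepend : ∀ {U u v w} → u ∈ U → Adj G u v → Walk G U v w → Walk G U u w
  walk-prepend u∈U uv (here v∈U)      = step (here u∈U) uv v∈U
  walk-prepend u∈U uv (step vx xw w∈U) = step (walk-prepend u∈U uv vx) xw w∈U

  walk-restrict : ∀ {U V v w} → (∀ {u} → Walk G U v u → u ∈ V) → Walk G U v w → Walk G V v w
  walk-restrict ⊆V p@(here _)       = here (⊆V p)
  walk-restrict ⊆V p@(step vu uw _) = step (walk-restrict ⊆V vu) uw (⊆V p)

  walk-transfer : ∀ {U V v w} → v ∈ V →
                  (∀ {u w} → u ∈ U → u ∈ V → Adj G u w → w ∈ U → w ∈ V) →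
                  Walk G U v w → Walk G V v w
  walk-transfer v∈V closed (here _)         = here v∈V
  walk-transfer v∈V closed (step vu uw w∈U) =
    step vu′ uw (closed (walk-end vu) (walk-end vu′) uw w∈U)
    where vu′ = walk-transfer v∈V closed vu

-- Reads off the summand of a sum given only by its unfolding; the summand of capacity is a
-- with-function local to its definition and cannot be named otherwise.
summand : ∀ {m} {f : Fin m → ℕ} s → s ≡ sumFin m f → Fin m → ℕ
summand {f = f} _ _ = f

module _ {G : Graph} {Y : Subset (n G)} {m} (L : ComponentLabelling G Y m) where

  same-component : ∀ {y w} → y ∈ Y → Walk G Y y w → comp L y ≡ comp L w
  same-component y∈Y yw = Equivalence.from (correct L _ _ y∈Y (walk-end yw)) yw

  connected : ∀ {y y′} → y ∈ Y → y′ ∈ Y → comp L y ≡ comp L y′ → Walk G Y y y′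
  connected y∈Y y′∈Y = Equivalence.to (correct L _ _ y∈Y y′∈Y)

  capacity≡∑ : ∀ c → capacity L c ≡ sum (λ y → 𝟙 (y ∈? Y) * 𝟙 (comp L y ≟ c))
  capacity≡∑ c = trans (sumFin≡sum (n G) _) (sum-cong-≗ summand≡)
    where
    summand≡ : ∀ y → summand (capacity L c) refl y ≡ 𝟙 (y ∈? Y) * 𝟙 (comp L y ≟ c)
    summand≡ y with y ∈? Y
    ... | no _  = refl
    ... | yes _ with comp L y ≟ c
    ...   | yes _ = refl
    ...   | no _  = refl

  ∑-*-capacity : ∀ (a : Fin m → ℕ) →
                 sum (λ c → a c * capacity L c) ≡ sum (λ y → 𝟙 (y ∈? Y) * a (comp L y))
  ∑-*-capacity a = begin
    sum (λ c → a c * capacity L c)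
      ≡⟨ sum-cong-≗ (λ c → cong (a c *_) (capacity≡∑ c)) ⟩
    sum (λ c → a c * sum (λ y → 𝟙 (y ∈? Y) * 𝟙 (comp L y ≟ c)))
      ≡⟨ sum-cong-≗ pull-in ⟩
    sum (λ c → sum (λ y → (𝟙 (y ∈? Y) * a c) * 𝟙 (comp L y ≟ c)))
      ≡⟨ ∑-∑-*-𝟙-≟ (comp L) (λ y c → 𝟙 (y ∈? Y) * a c) ⟩
    sum (λ y → 𝟙 (y ∈? Y) * a (comp L y))
      ∎
    where
    open ≡-Reasoning
    rearrange : ∀ u v w → u * (v * w) ≡ (v * u) * w
    rearrange u v w = trans (sym (*-assoc u v w)) (cong (_* w) (*-comm u v))
    pull-in : ∀ c → a c * sum (λ y → 𝟙 (y ∈? Y) * 𝟙 (comp L y ≟ c)) ≡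
                    sum (λ y → (𝟙 (y ∈? Y) * a c) * 𝟙 (comp L y ≟ c))
    pull-in c = trans (*-distribˡ-sum (a c) (λ y → 𝟙 (y ∈? Y) * 𝟙 (comp L y ≟ c)))
                      (sum-cong-≗ (λ y → rearrange (a c) (𝟙 (y ∈? Y)) (𝟙 (comp L y ≟ c))))

  capacity≤∣∣ : ∀ c (C : Subset (n G)) → (∀ y → y ∈ Y → comp L y ≡ c → y ∈ C) → capacity L c ≤ ∣ C ∣
  capacity≤∣∣ c C Y∩c⊆C = begin
    capacity L c                                    ≡⟨ capacity≡∑ c ⟩
    sum (λ y → 𝟙 (y ∈? Y) * 𝟙 (comp L y ≟ c))     ≤⟨ sum-mono-≤ in-C ⟩
    sum (λ y → 𝟙 (y ∈? C))                         ≡⟨ sym (∣p∣≡∑𝟙 C) ⟩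
    ∣ C ∣                                           ∎
    where
    open ≤-Reasoning
    in-C : ∀ y → 𝟙 (y ∈? Y) * 𝟙 (comp L y ≟ c) ≤ 𝟙 (y ∈? C)
    in-C y = ≤-trans
      (≤-reflexive (sym (𝟙-×-dec (y ∈? Y) (comp L y ≟ c))))
                     (𝟙-mono ((y ∈? Y) ×-dec (comp L y ≟ c)) (y ∈? C)
                             (λ (y∈Y , y∈c) → Y∩c⊆C y y∈Y y∈c))

  capacity≤ : ∀ {ℓ} → SmallComponents G ℓ Y → ∀ c → capacity L c ≤ ℓ
  capacity≤ Y-small c with onto L c
  ... | y₀ , y₀∈Y , refl with Y-small y₀ y₀∈Y
  ...   | C , ∣C∣≤ℓ , C-closed =
    ≤-trans (capacity≤∣∣ (comp L y₀) C (λ y y∈Y y∈c → C-closed y (connected y₀∈Y y∈Y (sym y∈c))))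
            ∣C∣≤ℓ

module WeightCounting
  {ℓ : ℕ} {G : Graph} {X Y : Subset (n G)} {m} {L : ComponentLabelling G Y m}
  {f : Fin (n G) → Fin m → ℕ}
  (X∩Y≡∅ : ∀ v → v ∈ X → v ∉ Y)
  (Y-small : SmallComponents G ℓ Y)
  (f-expansion : IsWeightedExpansion L X (2 * ℓ ∸ 1) f)
  {S : Subset (n G)} (S-solution : IsCOCSolution G ℓ S)
  where

  private
    f-support = proj₁ f-expansion
    f-load    = proj₁ (proj₂ f-expansion)
    f-demand  = proj₂ (proj₂ f-expansion)

  Meets : Fin m → Set
  Meets c = Σ (Fin (n G)) λ y → (y ∈ S ∩ Y) × (comp L y ≡ c)

  meets? : ∀ c → Dec (Meets c)
  meets? c = any? (λ y → (y ∈? S ∩ Y) ×-dec (comp L y ≟ c))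

  met-weight unmet-weight : Fin (n G) → ℕ
  met-weight   x = sum (λ c → 𝟙 (meets? c) * f x c)
  unmet-weight x = sum (λ c → 𝟙 (¬? (meets? c)) * f x c)

  weight≡met+unmet : ∀ x → sum (f x) ≡ met-weight x + unmet-weight x
  weight≡met+unmet x =
    trans (sum-cong-≗ split)
          (∑-distrib-+ (λ c → 𝟙 (meets? c) * f x c) (λ c → 𝟙 (¬? (meets? c)) * f x c))
    where
    split : ∀ c → f x c ≡ 𝟙 (meets? c) * f x c + 𝟙 (¬? (meets? c)) * f x c
    split c = begin
      f x c                                             ≡⟨ sym (*-identityˡ (f x c)) ⟩
      1 * f x c                                         ≡⟨ cong (_* f x c) (sym (𝟙+𝟙¬≡1 (meets? c))) ⟩
      (𝟙 (meets? c) + 𝟙 (¬? (meets? c))) * f x c       ≡⟨ *-distribʳ-+ (f x c) (𝟙 (meets? c)) _ ⟩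
      𝟙 (meets? c) * f x c + 𝟙 (¬? (meets? c)) * f x c  ∎
      where open ≡-Reasoning

  load≤capacity : ∀ c → sum (λ x → f x c) ≤ capacity L c
  load≤capacity c = ≤-trans (≤-reflexive (sym (sumFin≡sum (n G) (λ x → f x c)))) (f-load c)

  f≤capacity : ∀ x c → f x c ≤ capacity L c
  f≤capacity x c = ≤-trans (≤-sum (λ x → f x c) x) (load≤capacity c)

  walk-to-unmet : ∀ {x y} → x ∈ ∁ S → y ∈ Y → ¬ Meets (comp L y) → f x (comp L y) ≢ 0 →
                  Walk G (∁ S) x y
  walk-to-unmet {x} {y} x∈∁S y∈Y unmet fxy≢0 with f-support x (comp L y) fxy≢0
  ... | _ , y₀ , y₀∈Y , y₀~y , x~y₀ =
    walk-prepend x∈∁S x~y₀ (walk-restrict avoids-S (connected L y₀∈Y y∈Y y₀~y))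
    where
    avoids-S : ∀ {u} → Walk G Y y₀ u → u ∈ ∁ S
    avoids-S {u} y₀u with u ∈? S
    ... | no u∉S  = x∉p⇒x∈∁p u∉S
    ... | yes u∈S = ⊥-elim (unmet (u , x∈p∩q⁺ (u∈S , walk-end y₀u) ,
                                    trans (sym (same-component L y₀∈Y y₀u)) y₀~y))

  unmet-weight<ℓ : ∀ {x} → x ∈ X → x ∉ S → unmet-weight x < ℓ
  unmet-weight<ℓ {x} x∈X x∉S with S-solution x (x∉p⇒x∈∁p x∉S)
  ... | C , ∣C∣≤ℓ , C-closed = begin-strict
    unmet-weight x
      ≤⟨ sum-mono-≤ unmet≤touched ⟩
    sum (λ c → touched c * capacity L c)
      ≡⟨ ∑-*-capacity L touched ⟩
    sum touched-vertex
      <⟨ n<1+n (sum touched-vertex) ⟩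
    suc (sum touched-vertex)
      ≡⟨ +-comm 1 (sum touched-vertex) ⟩
    sum touched-vertex + 1
      ≡⟨ cong (sum touched-vertex +_) (sym (∑-𝟙-≟ x)) ⟩
    sum touched-vertex + sum (λ y → 𝟙 (x ≟ y))
      ≡⟨ sym (∑-distrib-+ touched-vertex (λ y → 𝟙 (x ≟ y))) ⟩
    sum (λ y → touched-vertex y + 𝟙 (x ≟ y))
      ≤⟨ sum-mono-≤ in-C ⟩
    sum (λ y → 𝟙 (y ∈? C))
      ≡⟨ sym (∣p∣≡∑𝟙 C) ⟩
    ∣ C ∣
      ≤⟨ ∣C∣≤ℓ ⟩
    ℓ ∎
    where
    open ≤-Reasoning
    x∈∁S = x∉p⇒x∈∁p x∉S
    touched? : ∀ c → Dec (¬ Meets c × f x c ≢ 0)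
    touched? c = ¬? (meets? c) ×-dec ¬? (f x c ℕ.≟ 0)
    touched : Fin m → ℕ
    touched c = 𝟙 (touched? c)
    unmet≤touched : ∀ c → 𝟙 (¬? (meets? c)) * f x c ≤ touched c * capacity L c
    unmet≤touched c = 𝟙-*-≤-support (¬? (meets? c)) (f≤capacity x c)
    touched-vertex : Fin (n G) → ℕ
    touched-vertex y = 𝟙 (y ∈? Y) * touched (comp L y)
    in-C : ∀ y → touched-vertex y + 𝟙 (x ≟ y) ≤ 𝟙 (y ∈? C)
    in-C y = ≤-trans
      (≤-reflexive (cong (_+ 𝟙 (x ≟ y)) (sym (𝟙-×-dec (y ∈? Y) (touched? (comp L y))))))
      (𝟙+𝟙-≤ ((y ∈? Y) ×-dec touched? (comp L y)) (x ≟ y) (y ∈? C)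
        (λ { (y∈Y , _) refl → X∩Y≡∅ x x∈X y∈Y })
        (λ (y∈Y , unmet , fxy≢0) → C-closed y (walk-to-unmet x∈∁S y∈Y unmet fxy≢0))
        (λ { refl → C-closed x (here x∈∁S) }))

  ℓ≤met-weight : ∀ {x} → x ∈ X → x ∉ S → ℓ ≤ met-weight x
  ℓ≤met-weight {x} x∈X x∉S = 2*m∸1≤n+o⇒o<m⇒m≤n demand (unmet-weight<ℓ x∈X x∉S)
    where
    open ≤-Reasoning
    demand : 2 * ℓ ∸ 1 ≤ met-weight x + unmet-weight x
    demand = begin
      2 * ℓ ∸ 1                      ≤⟨ f-demand x x∈X ⟩
      sumFin m (f x)                 ≡⟨ sumFin≡sum m (f x) ⟩
      sum (f x)                      ≡⟨ weight≡met+unmet x ⟩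
      met-weight x + unmet-weight x  ∎

  ∑𝟙meets≤∣S∩Y∣ : sum (λ c → 𝟙 (meets? c)) ≤ ∣ S ∩ Y ∣
  ∑𝟙meets≤∣S∩Y∣ = begin
    sum (λ c → 𝟙 (meets? c))
      ≤⟨ sum-mono-≤ (λ c → 𝟙-≤ (meets? c) witness) ⟩
    sum (λ c → sum (λ y → 𝟙 (y ∈? S ∩ Y) * 𝟙 (comp L y ≟ c)))
      ≡⟨ ∑-∑-*-𝟙-≟ (comp L) (λ y _ → 𝟙 (y ∈? S ∩ Y)) ⟩
    sum (λ y → 𝟙 (y ∈? S ∩ Y))
      ≡⟨ sym (∣p∣≡∑𝟙 (S ∩ Y)) ⟩
    ∣ S ∩ Y ∣ ∎
    where
    open ≤-Reasoning
    witness : ∀ {c} → Meets c → 1 ≤ sum (λ y → 𝟙 (y ∈? S ∩ Y) * 𝟙 (comp L y ≟ c))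
    witness {c} (y , y∈S∩Y , y∈c) =
      ≤-trans (≤-reflexive (sym (cong₂ _*_ (𝟙-≡1 (y ∈? S ∩ Y) y∈S∩Y) (𝟙-≡1 (comp L y ≟ c) y∈c))))
              (≤-sum (λ y → 𝟙 (y ∈? S ∩ Y) * 𝟙 (comp L y ≟ c)) y)

  ∣X∩∁S∣*ℓ≤∣S∩Y∣*ℓ : ∣ X ∩ ∁ S ∣ * ℓ ≤ ∣ S ∩ Y ∣ * ℓ
  ∣X∩∁S∣*ℓ≤∣S∩Y∣*ℓ = begin
    ∣ X ∩ ∁ S ∣ * ℓ
      ≡⟨ cong (_* ℓ) (∣p∣≡∑𝟙 (X ∩ ∁ S)) ⟩
    sum (λ x → 𝟙 (x ∈? X ∩ ∁ S)) * ℓ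
      ≡⟨ *-distribʳ-sum ℓ (λ x → 𝟙 (x ∈? X ∩ ∁ S)) ⟩
    sum (λ x → 𝟙 (x ∈? X ∩ ∁ S) * ℓ)
      ≤⟨ sum-mono-≤ (λ x → 𝟙-*-≤ (x ∈? X ∩ ∁ S) ℓ≤met-weight′) ⟩
    sum met-weight
      ≡⟨ ∑-comm (λ x c → 𝟙 (meets? c) * f x c) ⟩
    sum (λ c → sum (λ x → 𝟙 (meets? c) * f x c))
      ≡⟨ sum-cong-≗ (λ c → sym (*-distribˡ-sum (𝟙 (meets? c)) (λ x → f x c))) ⟩
    sum (λ c → 𝟙 (meets? c) * sum (λ x → f x c))
      ≤⟨ sum-mono-≤ (λ c → *-monoʳ-≤ (𝟙 (meets? c)) (load≤ℓ c)) ⟩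
    sum (λ c → 𝟙 (meets? c) * ℓ)
      ≡⟨ sym (*-distribʳ-sum ℓ (λ c → 𝟙 (meets? c))) ⟩
    sum (λ c → 𝟙 (meets? c)) * ℓ
      ≤⟨ *-monoˡ-≤ ℓ ∑𝟙meets≤∣S∩Y∣ ⟩
    ∣ S ∩ Y ∣ * ℓ ∎
    where
    open ≤-Reasoning
    ℓ≤met-weight′ : ∀ {x} → x ∈ X ∩ ∁ S → ℓ ≤ met-weight x
    ℓ≤met-weight′ x∈X∩∁S with x∈p∩q⁻ X (∁ S) x∈X∩∁S
    ... | x∈X , x∈∁S = ℓ≤met-weight x∈X (x∈∁p⇒x∉p x∈∁S)
    load≤ℓ : ∀ c → sum (λ x → f x c) ≤ ℓ
    load≤ℓ c = ≤-trans (load≤capacity c) (capacity≤ L Y-small c)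

  ∣X∩∁S∣≤∣S∩Y∣ : 1 ≤ ℓ → ∣ X ∩ ∁ S ∣ ≤ ∣ S ∩ Y ∣
  ∣X∩∁S∣≤∣S∩Y∣ 1≤ℓ = *-cancelʳ-≤ ∣ X ∩ ∁ S ∣ ∣ S ∩ Y ∣ ℓ {{>-nonZero 1≤ℓ}} ∣X∩∁S∣*ℓ≤∣S∩Y∣*ℓ

module Exchange {G : Graph} (X Y S : Subset (n G)) (X∩Y≡∅ : ∀ v → v ∈ X → v ∉ Y) where

  exchange : Subset (n G)
  exchange = (S ∩ ∁ Y) ∪ (X ∩ ∁ S)

  X⊆exchange : X ⊆ exchange
  X⊆exchange {x} x∈X with x ∈? S
  ... | yes x∈S = x∈p∪q⁺ (inj₁ (x∈p∩q⁺ (x∈S , x∉p⇒x∈∁p (X∩Y≡∅ x x∈X))))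
  ... | no  x∉S = x∈p∪q⁺ (inj₂ (x∈p∩q⁺ (x∈X , x∉p⇒x∈∁p x∉S)))

  exchange∩Y≡∅ : ∀ v → v ∈ exchange → v ∉ Y
  exchange∩Y≡∅ v v∈exchange with x∈p∪q⁻ (S ∩ ∁ Y) (X ∩ ∁ S) v∈exchange
  ... | inj₁ v∈S∩∁Y = x∈∁p⇒x∉p (proj₂ (x∈p∩q⁻ S (∁ Y) v∈S∩∁Y))
  ... | inj₂ v∈X∩∁S = X∩Y≡∅ v (proj₁ (x∈p∩q⁻ X (∁ S) v∈X∩∁S))

  ∣exchange∣≤∣S∣ : ∣ X ∩ ∁ S ∣ ≤ ∣ S ∩ Y ∣ → ∣ exchange ∣ ≤ ∣ S ∣
  ∣exchange∣≤∣S∣ ∣X∩∁S∣≤∣S∩Y∣ = begin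
    ∣ exchange ∣                   ≤⟨ ∣p∪q∣≤∣p∣+∣q∣ (S ∩ ∁ Y) (X ∩ ∁ S) ⟩
    ∣ S ∩ ∁ Y ∣ + ∣ X ∩ ∁ S ∣     ≤⟨ +-monoʳ-≤ ∣ S ∩ ∁ Y ∣ ∣X∩∁S∣≤∣S∩Y∣ ⟩
    ∣ S ∩ ∁ Y ∣ + ∣ S ∩ Y ∣       ≡⟨ +-comm ∣ S ∩ ∁ Y ∣ ∣ S ∩ Y ∣ ⟩
    ∣ S ∩ Y ∣ + ∣ S ∩ ∁ Y ∣       ≡⟨ sym (∣p∣≡∣p∩q∣+∣p∩∁q∣ S Y) ⟩
    ∣ S ∣                          ∎
    where open ≤-Reasoning

  ∈∁exchange⇒∉X : ∀ {v} → v ∈ ∁ exchange → v ∉ X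
  ∈∁exchange⇒∉X v∉exchange v∈X = x∈∁p⇒x∉p v∉exchange (X⊆exchange v∈X)

  ∈∁exchange⇒∉Y⇒∈∁S : ∀ {v} → v ∈ ∁ exchange → v ∉ Y → v ∈ ∁ S
  ∈∁exchange⇒∉Y⇒∈∁S {v} v∉exchange v∉Y with v ∈? S
  ... | no  v∉S = x∉p⇒x∈∁p v∉S
  ... | yes v∈S = ⊥-elim (x∈∁p⇒x∉p v∉exchange (x∈p∪q⁺ (inj₁ (x∈p∩q⁺ (v∈S , x∉p⇒x∈∁p v∉Y)))))

  exchange-solution : ∀ {ℓ} → (∀ y v → y ∈ Y → v ∉ Y → Adj G y v → v ∈ X) →
                      SmallComponents G ℓ Y → IsCOCSolution G ℓ S → IsCOCSolution G ℓ exchange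
  exchange-solution N[Y]⊆X Y-small S-solution v v∉exchange with v ∈? Y
  ... | yes v∈Y with Y-small v v∈Y
  ...   | C , ∣C∣≤ℓ , C-closed = C , ∣C∣≤ℓ , λ w vw → C-closed w (walk-transfer v∈Y stays-in-Y vw)
    where
    stays-in-Y : ∀ {u w} → u ∈ ∁ exchange → u ∈ Y → Adj G u w → w ∈ ∁ exchange → w ∈ Y
    stays-in-Y {u} {w} _ u∈Y uw w∉exchange with w ∈? Y
    ... | yes w∈Y = w∈Y
    ... | no  w∉Y = ⊥-elim (∈∁exchange⇒∉X w∉exchange (N[Y]⊆X u w u∈Y w∉Y uw))
  exchange-solution N[Y]⊆X Y-small S-solution v v∉exchange | no v∉Y
    with S-solution v (∈∁exchange⇒∉Y⇒∈∁S v∉exchange v∉Y)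
  ... | C , ∣C∣≤ℓ , C-closed =
    C , ∣C∣≤ℓ , λ w vw → C-closed w (walk-restrict in-∁S (walk-transfer v-out stays-out vw))
    where
    v-out : v ∈ ∁ S ∩ ∁ Y
    v-out = x∈p∩q⁺ (∈∁exchange⇒∉Y⇒∈∁S v∉exchange v∉Y , x∉p⇒x∈∁p v∉Y)
    stays-out : ∀ {u w} → u ∈ ∁ exchange → u ∈ ∁ S ∩ ∁ Y → Adj G u w → w ∈ ∁ exchange →
                w ∈ ∁ S ∩ ∁ Y
    stays-out {u} {w} u∉exchange u-out uw w∉exchange =
      x∈p∩q⁺ (∈∁exchange⇒∉Y⇒∈∁S w∉exchange w∉Y , x∉p⇒x∈∁p w∉Y)
      where
      w∉Y : w ∉ Y
      w∉Y w∈Y = ∈∁exchange⇒∉X u∉exchange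
        (N[Y]⊆X w u w∈Y (x∈∁p⇒x∉p (proj₂ (x∈p∩q⁻ (∁ S) (∁ Y) u-out))) (Graph.sym G uw))
    in-∁S : ∀ {u} → Walk G (∁ S ∩ ∁ Y) v u → u ∈ ∁ S
    in-∁S vu = proj₁ (x∈p∩q⁻ (∁ S) (∁ Y) (walk-end vu))

lemma18 : (ℓ : ℕ) → 1 ≤ ℓ → (G : Graph) → (k : ℕ) → (X Y : Subset (n G)) →
          ReduciblePair ℓ G X Y → YesInstance ℓ G k →
          Σ (Subset (n G)) λ S → (∣ S ∣ ≤ k) × IsCOCSolution G ℓ S ×
            (X ⊆ S) × (∀ v → v ∈ S → v ∉ Y)
lemma18 ℓ 1≤ℓ G k X Y (X∩Y≡∅ , N[Y]⊆X , Y-small , _ , L , _ , f-expansion)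
                      (S , ∣S∣≤k , S-solution) =
  exchange , ∣exchange∣≤k , exchange-solution N[Y]⊆X Y-small S-solution , X⊆exchange , exchange∩Y≡∅
  where
  open Exchange X Y S X∩Y≡∅
  open WeightCounting {L = L} X∩Y≡∅ Y-small f-expansion S-solution using (∣X∩∁S∣≤∣S∩Y∣)
  ∣exchange∣≤k : ∣ exchange ∣ ≤ k
  ∣exchange∣≤k = ≤-trans (∣exchange∣≤∣S∣ (∣X∩∁S∣≤∣S∩Y∣ 1≤ℓ)) ∣S∣≤k
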